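{- Let $A$ be a valid digraph on a set $V$ of $n+1$ nodes ($n\ge0$) consisting of $k$ arrows. Then the balanced Delannoy word $\mathrm{DP}(A)$ has length $2n$ and contains exactly $k$ copies of the letter $U$ and exactly $k$ copies of the letter $D$.
   Context: For a finite node set $V\subseteq\mathbb{P}$, an arrow $(x,y)$ with $x\ne y$ in $V$ has tail $x$, head $y$; it is forward if $x<y$, backward if $x>y$; its interval is $\{\min(x,y),\ldots,\max(x,y)\}$. Two arrows cross if their intervals $[a_1,a_2]$, $[b_1,b_2]$ satisfy $a_1<b_1<a_2<b_2$ or $b_1<a_1<b_2<a_2$; an arrow nests another if its interval contains the other's; two arrows nest if one nests the other. A valid digraph on $V$ is a set $A$ of arrows on $V$ such that: (1) no two arrows cross; (2) any two forward arrows nest; (3) no backward arrow nests a forward arrow; (4) no head of an arrow is the tail of another arrow. For $W\subseteq V$, $A_W$ denotes the arrows of $A$ with both endpoints in $W$. Words in letters $U,D$ (length 1) and $H$ (length 2); length of a word is the sum of letter lengths; $\epsilon$ empty word, $\cdot$ concatenation. $\mathrm{SP}$ (valid digraphs of backward arrows, $v=\min V$): $\mathrm{SP}(A)=\epsilon$ if $V=\{v\}$; $\mathrm{SP}(A)=H\cdot\mathrm{SP}(A_{V-\{v\}})$ if $v$ lies on no arrow; otherwise with $w=\min\{x:(x,v)\in A\}$, $\mathrm{SP}(A)=U\cdot\mathrm{SP}(A_{V\cap(v,w]})\cdot D\cdot\mathrm{SP}(A_{V-(v,w]})$. Twisting: for $A$ on $V$ containing $(v,w)$, $v=\min V$, $w=\max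 V$, $\mathrm{tw}(A)$ is the digraph on $V-\{v\}$ with arrows $A_{V-\{v\}}\cup\{(w,z):(v,z)\in A\}$. $\mathrm{DP}$: if $A$ has no forward arrow, $\mathrm{DP}(A)=\mathrm{SP}(A)$; otherwise with $(x,y)$ the forward arrow nesting all other forward arrows, $v=\min V$, $w=\max V$, $\mathrm{DP}(A)=\mathrm{SP}(A_{V\cap[v,x]})\cdot D\cdot\mathrm{DP}(\mathrm{tw}(A_{V\cap[x,y]}))\cdot U\cdot\mathrm{SP}(A_{V\cap[y,w]})$. -}

module Defs where

open import Data.Nat.Base using (ℕ; zero; suc; _≤_; _<_; _⊓_; _⊔_; _≡ᵇ_; _<ᵇ_; _≤ᵇ_; _+_)
open import Data.Bool.Base using (Bool; true; false; _∧_; _∨_; not)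
open import Data.List.Base using (List; []; _∷_; _++_; map; filterᵇ; foldr; length)
open import Data.Bool.ListAction using (all; any)
open import Data.List.Membership.Propositional using (_∈_)
open import Data.List.Relation.Unary.All using (All)
open import Data.List.Relation.Unary.Linked using (Linked)
open import Data.Maybe.Base using (Maybe; just; nothing)
open import Data.Product.Base using (_×_; _,_; proj₁; proj₂)
open import Data.Sum.Base using (_⊎_)
open import Relation.Binary.PropositionalEquality using (_≡_; _≢_)
open import Relation.Nullary using (¬_)

-- A finite node set V ⊆ ℙ (positive integers) is represented canonically
-- as a strictly increasing list of positive naturals.
IsNodeSet : List ℕ → Set
IsNodeSet V = Linked _<_ V × All (λ x → 1 ≤ x) V

Arrow : Set
Arrow = ℕ × ℕ

tailA : Arrow → ℕ
tailA = proj₁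

headA : Arrow → ℕ
headA = proj₂

Forward : Arrow → Set
Forward a = tailA a < headA a

Backward : Arrow → Set
Backward a = headA a < tailA a

lo hi : Arrow → ℕ
lo a = tailA a ⊓ headA a
hi a = tailA a ⊔ headA a

Cross : Arrow → Arrow → Set
Cross a b = (lo a < lo b × lo b < hi a × hi a < hi b)
          ⊎ (lo b < lo a × lo a < hi b × hi b < hi a)

Nests : Arrow → Arrow → Set
Nests a b = lo a ≤ lo b × hi b ≤ hi a

NestEachOther : Arrow → Arrow → Set
NestEachOther a b = Nests a b ⊎ Nests b a

-- A valid digraph on V: a set of arrows (given as a list; duplicate-freeness
-- is imposed separately where cardinality matters).
record ValidDigraph (V : List ℕ) (A : List Arrow) : Set where
  field
    arrowsOnV   : All (λ a → tailA a ∈ V × headA a ∈ V × tailA a ≢ headA a) A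
    noCross     : ∀ {a b} → a ∈ A → b ∈ A → ¬ Cross a b
    fwdNest     : ∀ {a b} → a ∈ A → b ∈ A → Forward a → Forward b → NestEachOther a b
    bwdNoNest   : ∀ {a b} → a ∈ A → b ∈ A → Backward a → Forward b → ¬ Nests a b
    headNotTail : ∀ {a b} → a ∈ A → b ∈ A → headA a ≢ tailA b

data Letter : Set where
  U D H : Letter

Word : Set
Word = List Letter

letterLength : Letter → ℕ
letterLength U = 1
letterLength D = 1
letterLength H = 2

wordLength : Word → ℕ
wordLength = foldr (λ l n → letterLength l + n) 0

isU isD : Letter → Bool
isU U = true
isU _ = false
isD D = true
isD _ = false

countU countD : Word → ℕ
countU w = length (filterᵇ isU w)
countD w = length (filterᵇ isD w)

inb : ℕ → List ℕ → Bool
inb x W = any (λ y → x ≡ᵇ y) W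

restrict : List ℕ → List Arrow → List Arrow
restrict W A = filterᵇ (λ a → inb (tailA a) W ∧ inb (headA a) W) A

onArrowᵇ : ℕ → Arrow → Bool
onArrowᵇ v a = (tailA a ≡ᵇ v) ∨ (headA a ≡ᵇ v)

minList1 : ℕ → List ℕ → ℕ
minList1 t ts = foldr _⊓_ t ts

maxList : List ℕ → ℕ
maxList = foldr _⊔_ 0

-- SP, with a fuel argument (structural recursion); the top-level SPw
-- supplies fuel |V|, which suffices since every recursive call is on a
-- strictly smaller node set.

SPf : ℕ → List ℕ → List Arrow → Word
SPf zero _ _ = []
SPf (suc f) [] A = []
SPf (suc f) (v ∷ []) A = []
SPf (suc f) (v ∷ V'@(_ ∷ _)) A with any (onArrowᵇ v) A
... | false = H ∷ SPf f V' (restrict V' A)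
... | true with map tailA (filterᵇ (λ a → headA a ≡ᵇ v) A)
...   | [] = []  -- unreachable for valid digraphs of backward arrows
...   | t ∷ ts =
        let w  = minList1 t ts
            inI : ℕ → Bool
            inI x = (v <ᵇ x) ∧ (x ≤ᵇ w)
            W1 = filterᵇ inI (v ∷ V')
            W2 = filterᵇ (λ x → not (inI x)) (v ∷ V')
        in U ∷ SPf f W1 (restrict W1 A) ++ D ∷ SPf f W2 (restrict W2 A)

SP : List ℕ → List Arrow → Word
SP V A = SPf (length V) V A

tw : List ℕ → List Arrow → List ℕ × List Arrow
tw [] A = [] , []
tw (v ∷ V') A =
  V' , (restrict V' A ++ map (λ a → maxList (v ∷ V') , headA a)
                              (filterᵇ (λ a → tailA a ≡ᵇ v) A))

isFwdᵇ : Arrow → Bool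
isFwdᵇ a = tailA a <ᵇ headA a

nestsᵇ : Arrow → Arrow → Bool
nestsᵇ a b = (lo a ≤ᵇ lo b) ∧ (hi b ≤ᵇ hi a)

findOuter : List Arrow → List Arrow → Maybe Arrow
findOuter [] fw = nothing
findOuter (a ∷ as) fw with all (nestsᵇ a) fw
... | true  = just a
... | false = findOuter as fw

DPf : ℕ → List ℕ → List Arrow → Word
DPf zero _ _ = []
DPf (suc f) V A with filterᵇ isFwdᵇ A
... | [] = SP V A
... | fw@(_ ∷ _) with findOuter fw fw
...   | nothing = []  -- unreachable for valid digraphs
...   | just (x , y) =
        let v  = minList1 x V
            w  = maxList V
            W1 = filterᵇ (λ z → (v ≤ᵇ z) ∧ (z ≤ᵇ x)) V
            W2 = filterᵇ (λ z → (x ≤ᵇ z) ∧ (z ≤ᵇ y)) V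
            W3 = filterᵇ (λ z → (y ≤ᵇ z) ∧ (z ≤ᵇ w)) V
            T  = tw W2 (restrict W2 A)
        in SP W1 (restrict W1 A) ++ D ∷ DPf f (proj₁ T) (proj₂ T)
             ++ U ∷ SP W3 (restrict W3 A)

DP : List ℕ → List Arrow → Word
DP V A = DPf (length V) V A

-- If the least node v lies on an
-- arrow, that arrow ends at v, and SP emits U … D for the arrow (w , v) with w least:
-- every other arrow lies inside (v , w] or outside it, since a backward arrow leaving
-- (v , w] would cross (w , v) or have its head at w, so the two subwords account for
-- the remaining arrows on a partition of the nodes.  DP cuts V at the outermost
-- forward arrow (x , y) into [min , x], [x , y] and [y , max], which share only x and
-- y and each receive their arrows intact; twisting the middle block deletes x and
-- turns (x , y) into a loop, so the letters D … U account for that arrow and node.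

module Submission where

open import Defs
open import Data.Bool.Base using (Bool; true; false; _∧_; _∨_; not)
open import Data.Bool.ListAction using (all; any)
open import Data.Bool.Properties
  using (∧-conicalˡ; ∧-conicalʳ; ∨-conicalˡ; ∨-conicalʳ; ∧-identityʳ; ∧-zeroʳ; ∨-zeroʳ; T-≡)
open import Data.Empty using (⊥; ⊥-elim)
open import Data.List.Base using (List; []; _∷_; _++_; map; filterᵇ; length)
open import Data.List.Membership.Propositional using (_∈_)
open import Data.List.Membership.Propositional.Properties using (∈-map⁺; ∈-map⁻; ∈-++⁻; ∈-filter⁺; ∈-filter⁻)
open import Data.List.Properties using (length-filter)
import Data.List.Relation.Unary.All as All
open import Data.List.Relation.Unary.AllPairs as AllPairs using (AllPairs; []; _∷_)
import Data.List.Relation.Unary.AllPairs.Properties as AllPairsₚ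
open import Data.List.Relation.Unary.Any as Any using (here; there)
open import Data.List.Relation.Unary.Linked.Properties using (Linked⇒AllPairs)
open import Data.List.Relation.Unary.Unique.Propositional using (Unique)
open import Data.Maybe.Base using (just; nothing)
open import Data.Nat.Base
open import Data.Nat.Properties
open import Data.Nat.Tactic.RingSolver using (solve-∀)
open import Data.Product.Base using (_×_; _,_; proj₁; proj₂; ∃; uncurry)
open import Data.Product.Properties using (≡-dec)
open import Data.Sum.Base using (_⊎_; inj₁; inj₂; [_,_]′)
open import Function.Base using (_∘_; case_of_)
open import Function.Bundles using (module Equivalence)
open import Relation.Binary.Definitions using (DecidableEquality; tri<; tri≈; tri>)
open import Relation.Binary.PropositionalEquality
open import Relation.Nullary using (¬_; Dec; yes; no; does)
open import Relation.Nullary.Decidable using (dec-true; dec-false; T?)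

module _ {a} {P : Set a} where

  dec-true⁻ : (p? : Dec P) → does p? ≡ true → P
  dec-true⁻ (yes p) _ = p
  dec-true⁻ (no _) ()

  dec-false⁻ : (p? : Dec P) → does p? ≡ false → ¬ P
  dec-false⁻ (no ¬p) _ = ¬p
  dec-false⁻ (yes _) ()

true≢false : true ≢ false
true≢false ()

∧-intro : ∀ {b c} → b ≡ true → c ≡ true → b ∧ c ≡ true
∧-intro refl refl = refl

∧-elim : ∀ {b c} → b ∧ c ≡ true → b ≡ true × c ≡ true
∧-elim {b} {c} e = ∧-conicalˡ b c e , ∧-conicalʳ b c e

module _ {a b} {P : Set a} {Q : Set b} where

  does-∧ : (p? : Dec P) (q? : Dec Q) → P → Q → does p? ∧ does q? ≡ true
  does-∧ p? q? p q rewrite dec-true p? p | dec-true q? q = refl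

  does-∧-false : (p? : Dec P) (q? : Dec Q) → (P → Q → ⊥) → does p? ∧ does q? ≡ false
  does-∧-false (yes p) (yes q) ¬pq = ⊥-elim (¬pq p q)
  does-∧-false (yes _) (no _) _ = refl
  does-∧-false (no _) _ _ = refl

  does-∧⁻ : (p? : Dec P) (q? : Dec Q) → does p? ∧ does q? ≡ true → P × Q
  does-∧⁻ p? q? e = let (ep , eq) = ∧-elim e in dec-true⁻ p? ep , dec-true⁻ q? eq

  does-∧-false⁻ : (p? : Dec P) (q? : Dec Q) → does p? ∧ does q? ≡ false → ¬ P ⊎ ¬ Q
  does-∧-false⁻ (yes _) (no ¬q) _ = inj₂ ¬q
  does-∧-false⁻ (no ¬p) _ _ = inj₁ ¬p
  does-∧-false⁻ (yes _) (yes _) ()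

any≡false : ∀ {X : Set} (p : X → Bool) {xs a} → any p xs ≡ false → a ∈ xs → p a ≡ false
any≡false p {x ∷ xs} e (here refl) = ∨-conicalˡ (p x) _ e
any≡false p {x ∷ xs} e (there m) = any≡false p (∨-conicalʳ (p x) _ e) m

any≡true : ∀ {X : Set} (p : X → Bool) xs → any p xs ≡ true → ∃ λ a → a ∈ xs × p a ≡ true
any≡true p (x ∷ xs) e with p x in px
... | true = x , here refl , px
... | false = let (a , m , pa) = any≡true p xs e in a , there m , pa

all≡true : ∀ {X : Set} (p : X → Bool) {xs a} → all p xs ≡ true → a ∈ xs → p a ≡ true
all≡true p {x ∷ xs} e (here refl) = ∧-conicalˡ (p x) _ e
all≡true p {x ∷ xs} e (there m) = all≡true p (∧-conicalʳ (p x) _ e) m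

all-intro : ∀ {X : Set} (p : X → Bool) xs → (∀ {a} → a ∈ xs → p a ≡ true) → all p xs ≡ true
all-intro p [] h = refl
all-intro p (x ∷ xs) h = ∧-intro (h (here refl)) (all-intro p xs (h ∘ there))

𝟙 : Bool → ℕ
𝟙 true = 1
𝟙 false = 0

count : {X : Set} → (X → Bool) → List X → ℕ
count p xs = length (filterᵇ p xs)

sumOver : {X : Set} → (X → ℕ) → List X → ℕ
sumOver f [] = 0
sumOver f (x ∷ xs) = f x + sumOver f xs

module _ {X : Set} where

  count-∷ : ∀ (p : X → Bool) x xs → count p (x ∷ xs) ≡ 𝟙 (p x) + count p xs
  count-∷ p x xs with p x
  ... | true = refl
  ... | false = refl

  count≡sumOver : ∀ (p : X → Bool) xs → count p xs ≡ sumOver (𝟙 ∘ p) xs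
  count≡sumOver p [] = refl
  count≡sumOver p (x ∷ xs) = trans (count-∷ p x xs) (cong (𝟙 (p x) +_) (count≡sumOver p xs))

  sumOver-cong : ∀ {f g : X → ℕ} xs → (∀ {a} → a ∈ xs → f a ≡ g a) → sumOver f xs ≡ sumOver g xs
  sumOver-cong [] h = refl
  sumOver-cong (x ∷ xs) h = cong₂ _+_ (h (here refl)) (sumOver-cong xs (h ∘ there))

  sumOver-+ : ∀ (f g : X → ℕ) xs → sumOver (λ a → f a + g a) xs ≡ sumOver f xs + sumOver g xs
  sumOver-+ f g [] = refl
  sumOver-+ f g (x ∷ xs) = trans (cong (f x + g x +_) (sumOver-+ f g xs)) (interchange (f x) (g x) _ _)
    where
    interchange : ∀ a b c d → a + b + (c + d) ≡ a + c + (b + d)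
    interchange = solve-∀

  count-+₃ : ∀ (p q r : X → Bool) xs
           → count p xs + count q xs + count r xs ≡ sumOver (λ a → 𝟙 (p a) + 𝟙 (q a) + 𝟙 (r a)) xs
  count-+₃ p q r xs = begin
      count p xs + count q xs + count r xs
        ≡⟨ cong₂ _+_ (cong₂ _+_ (count≡sumOver p xs) (count≡sumOver q xs)) (count≡sumOver r xs) ⟩
      sumOver (𝟙 ∘ p) xs + sumOver (𝟙 ∘ q) xs + sumOver (𝟙 ∘ r) xs
        ≡⟨ cong (_+ sumOver (𝟙 ∘ r) xs) (sumOver-+ (𝟙 ∘ p) (𝟙 ∘ q) xs) ⟨
      sumOver (λ a → 𝟙 (p a) + 𝟙 (q a)) xs + sumOver (𝟙 ∘ r) xs
        ≡⟨ sumOver-+ _ (𝟙 ∘ r) xs ⟨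
      sumOver (λ a → 𝟙 (p a) + 𝟙 (q a) + 𝟙 (r a)) xs ∎
    where open ≡-Reasoning

  count-split₃ : ∀ {p q r s : X → Bool} xs → (∀ {a} → a ∈ xs → 𝟙 (p a) ≡ 𝟙 (q a) + 𝟙 (r a) + 𝟙 (s a))
               → count p xs ≡ count q xs + count r xs + count s xs
  count-split₃ {p} {q} {r} {s} xs h =
    trans (count≡sumOver p xs) (trans (sumOver-cong xs h) (sym (count-+₃ q r s xs)))

  count-complement : ∀ (p : X → Bool) xs → count p xs + count (not ∘ p) xs ≡ length xs
  count-complement p [] = refl
  count-complement p (x ∷ xs) with p x
  ... | true = cong suc (count-complement p xs)
  ... | false = trans (+-suc _ _) (cong suc (count-complement p xs))

  count-true : ∀ xs → count (λ (_ : X) → true) xs ≡ length xs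
  count-true [] = refl
  count-true (x ∷ xs) = cong suc (count-true xs)

  count-cong : ∀ {p q : X → Bool} xs → (∀ {a} → a ∈ xs → p a ≡ q a) → count p xs ≡ count q xs
  count-cong {p} {q} xs h =
    trans (count≡sumOver p xs) (trans (sumOver-cong xs (cong 𝟙 ∘ h)) (sym (count≡sumOver q xs)))

  count-none : ∀ {p : X → Bool} xs → (∀ {a} → a ∈ xs → p a ≡ false) → count p xs ≡ 0
  count-none [] h = refl
  count-none {p} (x ∷ xs) h rewrite h (here refl) = count-none xs (h ∘ there)

  count-mono : ∀ {p q : X → Bool} xs → (∀ {a} → a ∈ xs → p a ≡ true → q a ≡ true) → count p xs ≤ count q xs
  count-mono [] h = z≤n
  count-mono {p} {q} (x ∷ xs) h with p x in px | q x in qx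
  ... | true | true = s≤s (count-mono xs (h ∘ there))
  ... | false | true = m≤n⇒m≤1+n (count-mono xs (h ∘ there))
  ... | false | false = count-mono xs (h ∘ there)
  ... | true | false with () ← trans (sym (h (here refl) px)) qx

  count-∈ : ∀ {p : X → Bool} {xs a} → a ∈ xs → p a ≡ true → 1 ≤ count p xs
  count-∈ {p} {x ∷ xs} (here refl) e rewrite e = s≤s z≤n
  count-∈ {p} {x ∷ xs} (there m) e with p x
  ... | true = s≤s z≤n
  ... | false = count-∈ m e

  count-++ : ∀ (p : X → Bool) xs ys → count p (xs ++ ys) ≡ count p xs + count p ys
  count-++ p [] ys = refl
  count-++ p (x ∷ xs) ys with p x
  ... | true = cong suc (count-++ p xs ys)
  ... | false = count-++ p xs ys

  count-filterᵇ : ∀ (p q : X → Bool) xs → count q (filterᵇ p xs) ≡ count (λ a → q a ∧ p a) xs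
  count-filterᵇ p q [] = refl
  count-filterᵇ p q (x ∷ xs) with p x
  ... | true with q x
  ...   | true  = cong suc (count-filterᵇ p q xs)
  ...   | false = count-filterᵇ p q xs
  count-filterᵇ p q (x ∷ xs) | false with q x
  ...   | true  = count-filterᵇ p q xs
  ...   | false = count-filterᵇ p q xs

count-map : ∀ {X Y : Set} (p : Y → Bool) (g : X → Y) xs → count p (map g xs) ≡ count (p ∘ g) xs
count-map p g [] = refl
count-map p g (x ∷ xs) with p (g x)
... | true = cong suc (count-map p g xs)
... | false = count-map p g xs

count-filterᵇ-≤ : ∀ {X : Set} (p q : X → Bool) xs → count q (filterᵇ p xs) ≤ count q xs
count-filterᵇ-≤ p q xs =
  ≤-trans (≤-reflexive (count-filterᵇ p q xs)) (count-mono xs (λ {a} _ → ∧-conicalˡ (q a) (p a)))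

module _ {X : Set} (p : X → Bool) where

  ∈-filterᵇ⁺ : ∀ {xs a} → a ∈ xs → p a ≡ true → a ∈ filterᵇ p xs
  ∈-filterᵇ⁺ m e = ∈-filter⁺ (T? ∘ p) m (Equivalence.from T-≡ e)

  ∈-filterᵇ⁻ : ∀ {xs a} → a ∈ filterᵇ p xs → a ∈ xs × p a ≡ true
  ∈-filterᵇ⁻ {xs} m = let (m' , t) = ∈-filter⁻ (T? ∘ p) {xs = xs} m in m' , Equivalence.to T-≡ t

inb⇒∈ : ∀ {x} W → inb x W ≡ true → x ∈ W
inb⇒∈ {x} (y ∷ W) e with x ≡ᵇ y in x≡y
... | true = here (dec-true⁻ (x ≟ y) x≡y)
... | false = there (inb⇒∈ W e)

∈⇒inb : ∀ {x W} → x ∈ W → inb x W ≡ true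
∈⇒inb {x} (here refl) rewrite dec-true (x ≟ x) refl = refl
∈⇒inb {x} {y ∷ W} (there m) rewrite ∈⇒inb m = ∨-zeroʳ (x ≡ᵇ y)

inb-filterᵇ : ∀ (P : ℕ → Bool) {V x} → x ∈ V → inb x (filterᵇ P V) ≡ P x
inb-filterᵇ P {V} {x} m with P x in e
... | true = ∈⇒inb (∈-filterᵇ⁺ P m e)
... | false with inb x (filterᵇ P V) in i
...   | false = refl
...   | true = trans (sym (proj₂ (∈-filterᵇ⁻ P {V} (inb⇒∈ (filterᵇ P V) i)))) e

minList1-∈ : ∀ t ts → minList1 t ts ∈ t ∷ ts
minList1-∈ t [] = here refl
minList1-∈ t (s ∷ ss) with ⊓-sel s (minList1 t ss)
... | inj₁ e rewrite e = there (here refl)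
... | inj₂ e rewrite e with minList1-∈ t ss
...   | here e' = here e'
...   | there m = there (there m)

minList1-≤ : ∀ t ts {z} → z ∈ t ∷ ts → minList1 t ts ≤ z
minList1-≤ t [] (here refl) = ≤-refl
minList1-≤ t (s ∷ ss) (here refl) = ≤-trans (m⊓n≤n s _) (minList1-≤ t ss (here refl))
minList1-≤ t (s ∷ ss) (there (here refl)) = m⊓n≤m s _
minList1-≤ t (s ∷ ss) (there (there m)) = ≤-trans (m⊓n≤n s _) (minList1-≤ t ss (there m))

≤maxList : ∀ {z} L → z ∈ L → z ≤ maxList L
≤maxList (x ∷ L) (here refl) = m≤m⊔n x _
≤maxList (x ∷ L) (there m) = ≤-trans (≤maxList L m) (m≤n⊔m x _)

maxList≤ : ∀ L {m} → (∀ {z} → z ∈ L → z ≤ m) → maxList L ≤ m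
maxList≤ [] h = z≤n
maxList≤ (x ∷ L) h = ⊔-lub (h (here refl)) (maxList≤ L (h ∘ there))

maxList≡ : ∀ L {y} → y ∈ L → (∀ {z} → z ∈ L → z ≤ y) → maxList L ≡ y
maxList≡ L m h = ≤-antisym (maxList≤ L h) (≤maxList L m)

head≤ : ∀ {v V z} → AllPairs _<_ (v ∷ V) → z ∈ v ∷ V → v ≤ z
head≤ s (here refl) = ≤-refl
head≤ (v<V ∷ _) (there m) = <⇒≤ (All.lookup v<V m)

count-≡ᵇ-sorted : ∀ {V x} → AllPairs _<_ V → x ∈ V → count (_≡ᵇ x) V ≡ 1
count-≡ᵇ-sorted {h ∷ V} {x} (h<V ∷ _) (here refl) rewrite dec-true (x ≟ x) refl =
  cong suc (count-none V (λ m → dec-false (_ ≟ x) (λ e → <-irrefl (sym e) (All.lookup h<V m))))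
count-≡ᵇ-sorted {h ∷ V} {x} (h<V ∷ s) (there m) rewrite dec-false (h ≟ x) (λ e → <-irrefl e (All.lookup h<V m)) =
  count-≡ᵇ-sorted s m

∈⇒1≤length : ∀ {X : Set} {L : List X} {x} → x ∈ L → 1 ≤ length L
∈⇒1≤length {L = _ ∷ _} _ = s≤s z≤n

fuel-split : ∀ {m n k f} → m + n ≡ k → 1 ≤ n → k ≤ suc f → m ≤ f
fuel-split {m} refl 1≤n k≤1+f = ≤-pred (≤-trans (m<m+n m 1≤n) k≤1+f)

NonLoop : Arrow → Set
NonLoop a = tailA a ≢ headA a

nonLoopᵇ : Arrow → Bool
nonLoopᵇ a = not (tailA a ≡ᵇ headA a)

arrowCount : List Arrow → ℕ
arrowCount = count nonLoopᵇ

nonLoopᵇ-true : ∀ {a} → NonLoop a → nonLoopᵇ a ≡ true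
nonLoopᵇ-true {t , h} nl = cong not (dec-false (t ≟ h) nl)

nonLoopᵇ-false : ∀ {a} → tailA a ≡ headA a → nonLoopᵇ a ≡ false
nonLoopᵇ-false {t , h} e = cong not (dec-true (t ≟ h) e)

_≟ₐ_ : DecidableEquality Arrow
_≟ₐ_ = ≡-dec _≟_ _≟_

multiplicity : Arrow → List Arrow → ℕ
multiplicity c = count (λ a → does (c ≟ₐ a))

multiplicity-∈ : ∀ {c A} → c ∈ A → multiplicity c A ≤ 1 → multiplicity c A ≡ 1
multiplicity-∈ {c} m le = ≤-antisym le (count-∈ m (dec-true (c ≟ₐ c) refl))

lo-elim : ∀ (P : ℕ → Set) a → P (tailA a) → P (headA a) → P (lo a)
lo-elim P (t , h) pt ph with ⊓-sel t h
... | inj₁ e = subst P (sym e) pt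
... | inj₂ e = subst P (sym e) ph

hi-elim : ∀ (P : ℕ → Set) a → P (tailA a) → P (headA a) → P (hi a)
hi-elim P (t , h) pt ph with ⊔-sel t h
... | inj₁ e = subst P (sym e) pt
... | inj₂ e = subst P (sym e) ph

lo-fwd : ∀ {a} → Forward a → lo a ≡ tailA a
lo-fwd f = m≤n⇒m⊓n≡m (<⇒≤ f)

hi-fwd : ∀ {a} → Forward a → hi a ≡ headA a
hi-fwd f = m≤n⇒m⊔n≡n (<⇒≤ f)

lo-bwd : ∀ {a} → Backward a → lo a ≡ headA a
lo-bwd b = m≥n⇒m⊓n≡n (<⇒≤ b)

hi-bwd : ∀ {a} → Backward a → hi a ≡ tailA a
hi-bwd b = m≥n⇒m⊔n≡m (<⇒≤ b)

lo≤tail : ∀ a → lo a ≤ tailA a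
lo≤tail (t , h) = m⊓n≤m t h

lo≤head : ∀ a → lo a ≤ headA a
lo≤head (t , h) = m⊓n≤n t h

tail≤hi : ∀ a → tailA a ≤ hi a
tail≤hi (t , h) = m≤m⊔n t h

head≤hi : ∀ a → headA a ≤ hi a
head≤hi (t , h) = m≤n⊔m t h

fwd⊎bwd : ∀ a → NonLoop a → Forward a ⊎ Backward a
fwd⊎bwd (t , h) nl with <-cmp t h
... | tri< t<h _ _ = inj₁ t<h
... | tri≈ _ t≡h _ = ⊥-elim (nl t≡h)
... | tri> _ _ t>h = inj₂ t>h

lo<hi : ∀ a → NonLoop a → lo a < hi a
lo<hi a nl with fwd⊎bwd a nl
... | inj₁ f = subst₂ _<_ (sym (lo-fwd f)) (sym (hi-fwd f)) f
... | inj₂ b = subst₂ _<_ (sym (lo-bwd b)) (sym (hi-bwd b)) b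

cross-sym : ∀ {a b} → Cross a b → Cross b a
cross-sym (inj₁ c) = inj₂ c
cross-sym (inj₂ c) = inj₁ c

nests-trans : ∀ {a b c} → Nests a b → Nests b c → Nests a c
nests-trans (p , q) (r , s) = ≤-trans p r , ≤-trans s q

-- Twisting turns the outermost forward arrow (x , y) into the loop (y , y) at the
-- top node, so the recursion runs through digraphs with loops there, possibly
-- repeated; loops are not counted by arrowCount, and only non-loops need be simple.
record Admissible (V : List ℕ) (A : List Arrow) : Set where
  field
    sorted      : AllPairs _<_ V
    endpoints   : ∀ {a} → a ∈ A → tailA a ∈ V × headA a ∈ V
    loopsAtTop  : ∀ {a} → a ∈ A → tailA a ≡ headA a → ∀ {z} → z ∈ V → z ≤ tailA a
    noCross     : ∀ {a b} → a ∈ A → b ∈ A → ¬ Cross a b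
    fwdNest     : ∀ {a b} → a ∈ A → b ∈ A → Forward a → Forward b → NestEachOther a b
    bwdNoNest   : ∀ {a b} → a ∈ A → b ∈ A → Backward a → Forward b → ¬ Nests a b
    headNotTail : ∀ {a b} → a ∈ A → b ∈ A → NonLoop a → NonLoop b → headA a ≢ tailA b
    simple      : ∀ c → NonLoop c → multiplicity c A ≤ 1

restrictᵇ : List ℕ → Arrow → Bool
restrictᵇ W a = inb (tailA a) W ∧ inb (headA a) W

∈-restrict⁻ : ∀ {W A a} → a ∈ restrict W A → a ∈ A × tailA a ∈ W × headA a ∈ W
∈-restrict⁻ {W} {A} {a} m =
  let (a∈A , e) = ∈-filterᵇ⁻ (restrictᵇ W) {A} m
      (t , h) = ∧-elim e
  in a∈A , inb⇒∈ W t , inb⇒∈ W h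

restrictᵇ-filterᵇ : ∀ (P : ℕ → Bool) {V a} → tailA a ∈ V → headA a ∈ V
                  → restrictᵇ (filterᵇ P V) a ≡ P (tailA a) ∧ P (headA a)
restrictᵇ-filterᵇ P t h = cong₂ _∧_ (inb-filterᵇ P t) (inb-filterᵇ P h)

arrowCount-restrict : ∀ W A → arrowCount (restrict W A) ≡ count (λ a → nonLoopᵇ a ∧ restrictᵇ W a) A
arrowCount-restrict W = count-filterᵇ (restrictᵇ W) nonLoopᵇ

restrict-admissible : ∀ {V A W} → Admissible V A → AllPairs _<_ W → (∀ {z} → z ∈ W → z ∈ V)
                    → Admissible W (restrict W A)
restrict-admissible {V} {A} {W} adm sortedW W⊆V = record
  { sorted      = sortedW
  ; endpoints   = λ m → proj₂ (∈-restrict⁻ {W} {A} m)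
  ; loopsAtTop  = λ m e z∈W → loopsAtTop (inA m) e (W⊆V z∈W)
  ; noCross     = λ m₁ m₂ → noCross (inA m₁) (inA m₂)
  ; fwdNest     = λ m₁ m₂ → fwdNest (inA m₁) (inA m₂)
  ; bwdNoNest   = λ m₁ m₂ → bwdNoNest (inA m₁) (inA m₂)
  ; headNotTail = λ m₁ m₂ → headNotTail (inA m₁) (inA m₂)
  ; simple      = λ c nl → ≤-trans (count-filterᵇ-≤ (restrictᵇ W) _ A) (simple c nl)
  }
  where
  open Admissible adm
  inA : ∀ {a} → a ∈ restrict W A → a ∈ A
  inA m = proj₁ (∈-restrict⁻ {W} {A} m)

multiplicity≤1 : ∀ {V A} → Admissible V A → ∀ c → (c ∈ A → NonLoop c) → multiplicity c A ≤ 1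
multiplicity≤1 {A = A} adm c nonLoopIfIn with tailA c ≟ headA c
... | no nl = Admissible.simple adm c nl
... | yes loop = subst (_≤ 1) (sym (count-none A (λ {a} m → dec-false (c ≟ₐ a) (λ { refl → nonLoopIfIn m loop })))) z≤n

-- Balanced words

wordLength-++ : ∀ xs ys → wordLength (xs ++ ys) ≡ wordLength xs + wordLength ys
wordLength-++ [] ys = refl
wordLength-++ (l ∷ xs) ys = trans (cong (letterLength l +_) (wordLength-++ xs ys)) (sym (+-assoc (letterLength l) _ _))

countU-++ : ∀ xs ys → countU (xs ++ ys) ≡ countU xs + countU ys
countU-++ xs ys = count-++ isU xs ys

countD-++ : ∀ xs ys → countD (xs ++ ys) ≡ countD xs + countD ys
countD-++ xs ys = count-++ isD xs ys

record Balanced (w : Word) (V : List ℕ) (A : List Arrow) : Set where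
  field
    length≡ : wordLength w + 2 ≡ 2 * length V
    countU≡ : countU w ≡ arrowCount A
    countD≡ : countD w ≡ arrowCount A

balanced-[] : ∀ {V A} → length V ≡ 1 → arrowCount A ≡ 0 → Balanced [] V A
balanced-[] lenV none = record
  { length≡ = cong (2 *_) (sym lenV) ; countU≡ = sym none ; countD≡ = sym none }

balanced-H : ∀ {s V' A' V A} → Balanced s V' A' → length V ≡ suc (length V') → arrowCount A ≡ arrowCount A'
           → Balanced (H ∷ s) V A
balanced-H {s} {V'} {V = V} bal lenV arrows = record
  { length≡ = begin
      2 + wordLength s + 2 ≡⟨ cong (2 +_) length≡ ⟩
      2 + 2 * length V'    ≡⟨ *-suc 2 (length V') ⟨
      2 * suc (length V')  ≡⟨ cong (2 *_) lenV ⟨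
      2 * length V         ∎
  ; countU≡ = trans countU≡ (sym arrows)
  ; countD≡ = trans countD≡ (sym arrows)
  }
  where open Balanced bal; open ≡-Reasoning

balanced-UD : ∀ {s₁ s₂ W₁ W₂ A₁ A₂ V A} → Balanced s₁ W₁ A₁ → Balanced s₂ W₂ A₂
            → length W₁ + length W₂ ≡ length V → arrowCount A ≡ suc (arrowCount A₁ + arrowCount A₂)
            → Balanced (U ∷ s₁ ++ D ∷ s₂) V A
balanced-UD {s₁} {s₂} {W₁} {W₂} {A₁} {A₂} {V} {A} bal₁ bal₂ lenV arrows = record
  { length≡ = begin
      suc (wordLength (s₁ ++ D ∷ s₂)) + 2          ≡⟨ cong (λ n → suc n + 2) (wordLength-++ s₁ (D ∷ s₂)) ⟩
      suc (wordLength s₁ + suc (wordLength s₂)) + 2 ≡⟨ regroup (wordLength s₁) (wordLength s₂) ⟩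
      (wordLength s₁ + 2) + (wordLength s₂ + 2)     ≡⟨ cong₂ _+_ (B₁.length≡) (B₂.length≡) ⟩
      2 * length W₁ + 2 * length W₂                 ≡⟨ *-distribˡ-+ 2 (length W₁) _ ⟨
      2 * (length W₁ + length W₂)                   ≡⟨ cong (2 *_) lenV ⟩
      2 * length V                                  ∎
  ; countU≡ = begin
      suc (countU (s₁ ++ D ∷ s₂))               ≡⟨ cong suc (countU-++ s₁ (D ∷ s₂)) ⟩
      suc (countU s₁ + countU s₂)               ≡⟨ cong suc (cong₂ _+_ B₁.countU≡ B₂.countU≡) ⟩
      suc (arrowCount A₁ + arrowCount A₂)       ≡⟨ arrows ⟨
      arrowCount A                              ∎
  ; countD≡ = begin
      countD (s₁ ++ D ∷ s₂)                     ≡⟨ countD-++ s₁ (D ∷ s₂) ⟩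
      countD s₁ + suc (countD s₂)               ≡⟨ +-suc _ _ ⟩
      suc (countD s₁ + countD s₂)               ≡⟨ cong suc (cong₂ _+_ B₁.countD≡ B₂.countD≡) ⟩
      suc (arrowCount A₁ + arrowCount A₂)       ≡⟨ arrows ⟨
      arrowCount A                              ∎
  }
  where
  module B₁ = Balanced bal₁
  module B₂ = Balanced bal₂
  open ≡-Reasoning
  regroup : ∀ a b → suc (a + suc b) + 2 ≡ (a + 2) + (b + 2)
  regroup = solve-∀

balanced-DU : ∀ {s₁ m s₃ W₁ W₂ W₃ A₁ A₂ A₃ V A}
            → Balanced s₁ W₁ A₁ → Balanced m W₂ A₂ → Balanced s₃ W₃ A₃
            → length W₁ + suc (length W₂) + length W₃ ≡ length V + 2
            → arrowCount A ≡ arrowCount A₁ + suc (arrowCount A₂) + arrowCount A₃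
            → Balanced (s₁ ++ D ∷ m ++ U ∷ s₃) V A
balanced-DU {s₁} {m} {s₃} {W₁} {W₂} {W₃} {A₁} {A₂} {A₃} {V} {A} bal₁ bal₂ bal₃ lenV arrows = record
  { length≡ = +-cancelʳ-≡ 4 _ _ (begin
      wordLength (s₁ ++ D ∷ m ++ U ∷ s₃) + 2 + 4
        ≡⟨ cong (λ n → n + 2 + 4) (trans (wordLength-++ s₁ _) (cong (λ n → wordLength s₁ + suc n) (wordLength-++ m _))) ⟩
      wordLength s₁ + suc (wordLength m + suc (wordLength s₃)) + 2 + 4
        ≡⟨ regroup (wordLength s₁) (wordLength m) (wordLength s₃) ⟩
      (wordLength s₁ + 2) + (wordLength m + 2 + 2) + (wordLength s₃ + 2)
        ≡⟨ cong₂ _+_ (cong₂ _+_ B₁.length≡ (cong (_+ 2) B₂.length≡)) B₃.length≡ ⟩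
      2 * length W₁ + (2 * length W₂ + 2) + 2 * length W₃
        ≡⟨ double (length W₁) (length W₂) (length W₃) ⟩
      2 * (length W₁ + suc (length W₂) + length W₃)
        ≡⟨ cong (2 *_) lenV ⟩
      2 * (length V + 2)
        ≡⟨ *-distribˡ-+ 2 (length V) 2 ⟩
      2 * length V + 4 ∎)
  ; countU≡ = begin
      countU (s₁ ++ D ∷ m ++ U ∷ s₃)
        ≡⟨ trans (countU-++ s₁ _) (cong (countU s₁ +_) (countU-++ m _)) ⟩
      countU s₁ + (countU m + suc (countU s₃))
        ≡⟨ cong₂ (λ a b → a + (b + suc (countU s₃))) B₁.countU≡ B₂.countU≡ ⟩
      arrowCount A₁ + (arrowCount A₂ + suc (countU s₃))
        ≡⟨ cong (λ c → arrowCount A₁ + (arrowCount A₂ + suc c)) B₃.countU≡ ⟩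
      arrowCount A₁ + (arrowCount A₂ + suc (arrowCount A₃))
        ≡⟨ shift (arrowCount A₁) _ _ ⟩
      arrowCount A₁ + suc (arrowCount A₂) + arrowCount A₃
        ≡⟨ arrows ⟨
      arrowCount A ∎
  ; countD≡ = begin
      countD (s₁ ++ D ∷ m ++ U ∷ s₃)
        ≡⟨ trans (countD-++ s₁ _) (cong (λ n → countD s₁ + suc n) (countD-++ m _)) ⟩
      countD s₁ + suc (countD m + countD s₃)
        ≡⟨ cong₂ (λ a b → a + suc b) B₁.countD≡ (cong₂ _+_ B₂.countD≡ B₃.countD≡) ⟩
      arrowCount A₁ + suc (arrowCount A₂ + arrowCount A₃)
        ≡⟨ +-assoc (arrowCount A₁) _ _ ⟨
      arrowCount A₁ + suc (arrowCount A₂) + arrowCount A₃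
        ≡⟨ arrows ⟨
      arrowCount A ∎
  }
  where
  module B₁ = Balanced bal₁
  module B₂ = Balanced bal₂
  module B₃ = Balanced bal₃
  open ≡-Reasoning
  regroup : ∀ a b c → a + suc (b + suc c) + 2 + 4 ≡ (a + 2) + (b + 2 + 2) + (c + 2)
  regroup = solve-∀
  double : ∀ p q r → 2 * p + (2 * q + 2) + 2 * r ≡ 2 * (p + suc q + r)
  double = solve-∀
  shift : ∀ a b c → a + (b + suc c) ≡ a + suc b + c
  shift = solve-∀

-- SP

NoForward : List Arrow → Set
NoForward A = ∀ {a} → a ∈ A → ¬ Forward a

restrict-noForward : ∀ W {A} → NoForward A → NoForward (restrict W A)
restrict-noForward W {A} noFwd m = noFwd (proj₁ (∈-restrict⁻ {W} {A} m))

SP-BalancedUpTo : ℕ → Set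
SP-BalancedUpTo f = ∀ V A → length V ≤ f → 1 ≤ length V → Admissible V A → NoForward A → Balanced (SPf f V A) V A

bottom-nonLoop : ∀ {v u us A a} → Admissible (v ∷ u ∷ us) A → a ∈ A → tailA a ≡ v → NonLoop a
bottom-nonLoop adm m tv loop with Admissible.sorted adm
... | v<V ∷ _ = <⇒≱ (All.lookup v<V (here refl)) (subst (_ ≤_) tv (Admissible.loopsAtTop adm m loop (there (here refl))))

module SP-split
  (f v u : ℕ) (us : List ℕ) (A : List Arrow) (t : ℕ) (ts : List ℕ)
  (IH : SP-BalancedUpTo f)
  (adm : Admissible (v ∷ u ∷ us) A) (noFwd : NoForward A) (len : length (v ∷ u ∷ us) ≤ suc f)
  (tails : map tailA (filterᵇ (λ a → headA a ≡ᵇ v) A) ≡ t ∷ ts)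
  where

  open Admissible adm

  V : List ℕ
  V = v ∷ u ∷ us
  w : ℕ
  w = minList1 t ts

  intoV : Arrow → Bool
  intoV a = headA a ≡ᵇ v

  private
    attained : ∃ λ e → e ∈ filterᵇ intoV A × w ≡ tailA e
    attained = ∈-map⁻ tailA (subst (w ∈_) (sym tails) (minList1-∈ t ts))

  e : Arrow
  e = proj₁ attained

  e∈A : e ∈ A
  e∈A = proj₁ (∈-filterᵇ⁻ intoV {A} (proj₁ (proj₂ attained)))

  head-e : headA e ≡ v
  head-e = dec-true⁻ (headA e ≟ v) (proj₂ (∈-filterᵇ⁻ intoV {A} (proj₁ (proj₂ attained))))

  tail-e : tailA e ≡ w
  tail-e = sym (proj₂ (proj₂ attained))

  w-minimal : ∀ {a} → a ∈ A → headA a ≡ v → w ≤ tailA a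
  w-minimal {a} m h =
    minList1-≤ t ts (subst (tailA a ∈_) tails (∈-map⁺ tailA (∈-filterᵇ⁺ intoV m (dec-true (headA a ≟ v) h))))

  e-nonLoop : NonLoop e
  e-nonLoop loop = bottom-nonLoop adm e∈A (trans loop head-e) loop

  backward : ∀ {a} → a ∈ A → NonLoop a → Backward a
  backward {a} m nl = [ (λ fw → ⊥-elim (noFwd m fw)) , (λ bw → bw) ]′ (fwd⊎bwd a nl)

  e-backward : Backward e
  e-backward = backward e∈A e-nonLoop

  v<w : v < w
  v<w = subst₂ _<_ head-e tail-e e-backward

  inI : ℕ → Bool
  inI x = (v <ᵇ x) ∧ (x ≤ᵇ w)

  W₁ W₂ : List ℕ
  W₁ = filterᵇ inI V
  W₂ = filterᵇ (λ x → not (inI x)) V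

  inI-w : inI w ≡ true
  inI-w = does-∧ (v <? w) (w ≤? w) v<w ≤-refl

  inI-v : inI v ≡ false
  inI-v = does-∧-false (v <? v) (v ≤? w) (λ v<v _ → <-irrefl refl v<v)

  ≢e-by-head : ∀ {a} → inI (headA a) ≡ true → e ≢ a
  ≢e-by-head ih refl = true≢false (trans (sym ih) (trans (cong inI head-e) inI-v))

  ≢e-by-tail : ∀ {a} → inI (tailA a) ≡ false → e ≢ a
  ≢e-by-tail it refl = true≢false (trans (trans (sym inI-w) (cong inI (sym tail-e))) it)

  data Side (a : Arrow) : Set where
    inside  : inI (tailA a) ≡ true → inI (headA a) ≡ true → Side a
    outside : inI (tailA a) ≡ false → inI (headA a) ≡ false → Side a
    is-e    : a ≡ e → Side a

  side : ∀ {a} → a ∈ A → NonLoop a → Side a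
  side {a} m nl with inI (tailA a) in it | inI (headA a) in ih
  ... | true  | true  = inside it ih
  ... | false | false = outside it ih
  ... | true  | false = is-e (cong₂ _,_ (trans t≡w (sym tail-e)) (trans h≡v (sym head-e)))
    where
    h<t : headA a < tailA a
    h<t = backward m nl
    h≡v : headA a ≡ v
    h≡v with does-∧-false⁻ (v <? headA a) (headA a ≤? w) ih
    ... | inj₁ v≮h = ≤-antisym (≮⇒≥ v≮h) (head≤ sorted (proj₂ (endpoints m)))
    ... | inj₂ h≰w = ⊥-elim (h≰w (<⇒≤ (<-≤-trans h<t (proj₂ (does-∧⁻ (v <? tailA a) (tailA a ≤? w) it)))))
    t≡w : tailA a ≡ w
    t≡w = ≤-antisym (proj₂ (does-∧⁻ (v <? tailA a) (tailA a ≤? w) it)) (w-minimal m h≡v)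
  ... | false | true  = ⊥-elim crossing
    where
    h<t : headA a < tailA a
    h<t = backward m nl
    v<h : v < headA a
    v<h = proj₁ (does-∧⁻ (v <? headA a) (headA a ≤? w) ih)
    h≤w : headA a ≤ w
    h≤w = proj₂ (does-∧⁻ (v <? headA a) (headA a ≤? w) ih)
    w<t : w < tailA a
    w<t with does-∧-false⁻ (v <? tailA a) (tailA a ≤? w) it
    ... | inj₁ v≮t = ⊥-elim (v≮t (<-trans v<h h<t))
    ... | inj₂ t≰w = ≰⇒> t≰w
    crossing : ⊥
    crossing with m≤n⇒m<n∨m≡n h≤w
    ... | inj₂ h≡w = headNotTail m e∈A nl e-nonLoop (trans h≡w (sym tail-e))
    ... | inj₁ h<w = noCross e∈A m (inj₁
          ( subst₂ _<_ (trans (sym head-e) (sym (lo-bwd e-backward))) (sym (lo-bwd h<t)) v<h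
          , subst₂ _<_ (sym (lo-bwd h<t)) (trans (sym tail-e) (sym (hi-bwd e-backward))) h<w
          , subst₂ _<_ (trans (sym tail-e) (sym (hi-bwd e-backward))) (sym (hi-bwd h<t)) w<t ))

  arrow-sides : ∀ {a} → a ∈ A → 𝟙 (nonLoopᵇ a) ≡ 𝟙 (nonLoopᵇ a ∧ restrictᵇ W₁ a) + 𝟙 (nonLoopᵇ a ∧ restrictᵇ W₂ a)
                                            + 𝟙 (does (e ≟ₐ a))
  arrow-sides {a} m with tailA a ≟ headA a
  ... | yes loop rewrite nonLoopᵇ-false {a} loop
                       | dec-false (e ≟ₐ a) (λ e≡a → e-nonLoop (subst (λ b → tailA b ≡ headA b) (sym e≡a) loop)) = refl
  ... | no nl rewrite nonLoopᵇ-true {a} nl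
                    | restrictᵇ-filterᵇ inI (proj₁ (endpoints m)) (proj₂ (endpoints m))
                    | restrictᵇ-filterᵇ (λ x → not (inI x)) (proj₁ (endpoints m)) (proj₂ (endpoints m))
                    with side m nl
  ...   | inside it ih rewrite it | ih
          | dec-false (e ≟ₐ a) (≢e-by-head ih) = refl
  ...   | outside it ih rewrite it | ih
          | dec-false (e ≟ₐ a) (≢e-by-tail it) = refl
  ...   | is-e refl rewrite dec-true (e ≟ₐ e) refl | tail-e | head-e | inI-w | inI-v = refl

  partition : arrowCount A ≡ suc (arrowCount (restrict W₁ A) + arrowCount (restrict W₂ A))
  partition = begin
    arrowCount A
      ≡⟨ count-split₃ A arrow-sides ⟩
    count (λ a → nonLoopᵇ a ∧ restrictᵇ W₁ a) A + count (λ a → nonLoopᵇ a ∧ restrictᵇ W₂ a) A + multiplicity e A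
      ≡⟨ cong₂ _+_ (sym (cong₂ _+_ (arrowCount-restrict W₁ A) (arrowCount-restrict W₂ A)))
                   (multiplicity-∈ e∈A (simple e e-nonLoop)) ⟩
    arrowCount (restrict W₁ A) + arrowCount (restrict W₂ A) + 1
      ≡⟨ +-comm _ 1 ⟩
    suc (arrowCount (restrict W₁ A) + arrowCount (restrict W₂ A)) ∎
    where open ≡-Reasoning

  w∈W₁ : w ∈ W₁
  w∈W₁ = ∈-filterᵇ⁺ inI (subst (_∈ V) tail-e (proj₁ (endpoints e∈A))) inI-w

  v∈W₂ : v ∈ W₂
  v∈W₂ = ∈-filterᵇ⁺ (λ x → not (inI x)) (here refl) (cong not inI-v)

  lengths : length W₁ + length W₂ ≡ length V
  lengths = count-complement inI V

  balanced : Balanced (U ∷ SPf f W₁ (restrict W₁ A) ++ D ∷ SPf f W₂ (restrict W₂ A)) V A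
  balanced = balanced-UD (part inI (fuel-split lengths (∈⇒1≤length v∈W₂) len) w∈W₁)
                         (part (λ x → not (inI x))
                               (fuel-split (trans (+-comm (length W₂) (length W₁)) lengths) (∈⇒1≤length w∈W₁) len) v∈W₂)
                         lengths partition
    where
    part : ∀ P {x} → length (filterᵇ P V) ≤ f → x ∈ filterᵇ P V
         → Balanced (SPf f (filterᵇ P V) (restrict (filterᵇ P V) A)) (filterᵇ P V) (restrict (filterᵇ P V) A)
    part P fuel x∈W = IH (filterᵇ P V) (restrict (filterᵇ P V) A) fuel (∈⇒1≤length x∈W)
      (restrict-admissible adm (AllPairsₚ.filter⁺ (T? ∘ P) sorted) (proj₁ ∘ ∈-filterᵇ⁻ P {V}))
      (restrict-noForward (filterᵇ P V) noFwd)

SP-balanced : ∀ f → SP-BalancedUpTo f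
SP-balanced zero (_ ∷ _) A () _ _ _
SP-balanced (suc f) [] A _ () _ _
SP-balanced (suc f) (v ∷ []) A _ _ adm _ =
  balanced-[] refl (count-none A (nonLoopᵇ-false ∘ loop))
  where
  loop : ∀ {a} → a ∈ A → tailA a ≡ headA a
  loop m with Admissible.endpoints adm m
  ... | here t≡v , here h≡v = trans t≡v (sym h≡v)
SP-balanced (suc f) (v ∷ u ∷ us) A len _ adm noFwd with any (onArrowᵇ v) A in touching
... | false = balanced-H (SP-balanced f (u ∷ us) (restrict (u ∷ us) A) (≤-pred len) (s≤s z≤n)
                            (restrict-admissible adm (AllPairs.tail sorted) there) (restrict-noForward (u ∷ us) noFwd))
                         refl (sym untouched)
  where
  open Admissible adm
  inside : ∀ {a} → a ∈ A → restrictᵇ (u ∷ us) a ≡ true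
  inside {a} m = let avoids = any≡false (onArrowᵇ v) touching m in
    ∧-intro (∈⇒inb (Any.tail (dec-false⁻ (tailA a ≟ v) (∨-conicalˡ _ _ avoids)) (proj₁ (endpoints m))))
            (∈⇒inb (Any.tail (dec-false⁻ (headA a ≟ v) (∨-conicalʳ _ _ avoids)) (proj₂ (endpoints m))))
  untouched : arrowCount (restrict (u ∷ us) A) ≡ arrowCount A
  untouched = trans (arrowCount-restrict (u ∷ us) A)
                    (count-cong A (λ {a} m → trans (cong (nonLoopᵇ a ∧_) (inside m)) (∧-identityʳ (nonLoopᵇ a))))
... | true with map tailA (filterᵇ (λ a → headA a ≡ᵇ v) A) in tails
...   | t ∷ ts = SP-split.balanced f v u us A t ts (SP-balanced f) adm noFwd len tails
...   | [] = ⊥-elim (noArrowInto (any≡true (onArrowᵇ v) A touching))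
  where
  open Admissible adm
  noArrowInto : (∃ λ a → a ∈ A × onArrowᵇ v a ≡ true) → ⊥
  noArrowInto (a , m , on) with headA a ≟ v | tailA a ≟ v
  ... | yes h≡v | _
      with () ← subst (tailA a ∈_) tails (∈-map⁺ tailA (∈-filterᵇ⁺ (λ b → headA b ≡ᵇ v) m (dec-true (headA a ≟ v) h≡v)))
  ... | no h≢v | no t≢v =
      true≢false (trans (sym on) (cong₂ _∨_ (dec-false (tailA a ≟ v) t≢v) (dec-false (headA a ≟ v) h≢v)))
  ... | no _ | yes t≡v with fwd⊎bwd a (bottom-nonLoop adm m t≡v)
  ...   | inj₁ fw = noFwd m fw
  ...   | inj₂ bw = <⇒≱ (subst (headA a <_) t≡v bw) (head≤ sorted (proj₂ (endpoints m)))

-- Twisting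

module Twist
  (x y : ℕ) (V' : List ℕ) (B : List Arrow) (adm : Admissible (x ∷ V') B)
  (xy∈B : (x , y) ∈ B) (x<y : x < y) (y∈V' : y ∈ V') (y-max : ∀ {z} → z ∈ V' → z ≤ y)
  where

  open Admissible adm

  top : ℕ
  top = maxList (x ∷ V')

  top≡y : top ≡ y
  top≡y = maxList≡ (x ∷ V') (there y∈V') λ { (here refl) → <⇒≤ x<y ; (there m) → y-max m }

  isFromX : Arrow → Bool
  isFromX a = tailA a ≡ᵇ x

  twistArrow : Arrow → Arrow
  twistArrow a = top , headA a

  T : List Arrow
  T = restrict V' B ++ map twistArrow (filterᵇ isFromX B)

  x<V' : ∀ {z} → z ∈ V' → x < z
  x<V' m with sorted
  ... | x<V ∷ _ = All.lookup x<V m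

  xy-nonLoop : NonLoop (x , y)
  xy-nonLoop = <⇒≢ x<y

  from-x : ∀ {z} → (x , z) ∈ B → x < z × z ∈ V'
  from-x {z} m with proj₂ (endpoints m)
  ... | here z≡x = ⊥-elim (<⇒≱ x<y (loopsAtTop m (sym z≡x) (there y∈V')))
  ... | there z∈V' = x<V' z∈V' , z∈V'

  data Twisted (a : Arrow) : Set where
    old : a ∈ B → tailA a ∈ V' → headA a ∈ V' → Twisted a
    new : ∀ z → a ≡ (y , z) → (x , z) ∈ B → Twisted a

  classify : ∀ {a} → a ∈ T → Twisted a
  classify {a} m with ∈-++⁻ (restrict V' B) m
  ... | inj₁ m₁ = let (a∈B , t , h) = ∈-restrict⁻ {V'} {B} m₁ in old a∈B t h
  ... | inj₂ m₂ with ∈-map⁻ twistArrow m₂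
  ...   | b , b∈F , refl with ∈-filterᵇ⁻ isFromX {B} b∈F
  ...     | b∈B , fromX = new (headA b) (cong (_, headA b) top≡y)
                              (subst (_∈ B) (cong (_, headA b) (dec-true⁻ (tailA b ≟ x) fromX)) b∈B)

  z≤y : ∀ {z} → (x , z) ∈ B → z ≤ y
  z≤y m = y-max (proj₂ (from-x m))

  lo-new : ∀ {z} → (x , z) ∈ B → lo (y , z) ≡ z
  lo-new m = m≥n⇒m⊓n≡n (z≤y m)

  hi-new : ∀ {z} → (x , z) ∈ B → hi (y , z) ≡ y
  hi-new m = m≥n⇒m⊔n≡m (z≤y m)

  new-notForward : ∀ {z} → (x , z) ∈ B → ¬ Forward (y , z)
  new-notForward m fw = <⇒≱ fw (z≤y m)

  x<lo-old : ∀ {a} → tailA a ∈ V' → headA a ∈ V' → x < lo a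
  x<lo-old {a} t h = lo-elim (x <_) a (x<V' t) (x<V' h)

  hi-old≤y : ∀ {a} → tailA a ∈ V' → headA a ∈ V' → hi a ≤ y
  hi-old≤y {a} t h = hi-elim (_≤ y) a (y-max t) (y-max h)

  old-new-noCross : ∀ {a z} → a ∈ B → tailA a ∈ V' → headA a ∈ V' → (x , z) ∈ B → ¬ Cross a (y , z)
  old-new-noCross {a} {z} a∈B t h xz∈B (inj₁ (lo<z , z<hi , _)) =
    noCross xz∈B a∈B (inj₁ ( subst (_< lo a) (sym (lo-fwd x<z)) (x<lo-old t h)
                           , subst (lo a <_) (trans (lo-new xz∈B) (sym (hi-fwd x<z))) lo<z
                           , subst (_< hi a) (trans (lo-new xz∈B) (sym (hi-fwd x<z))) z<hi ))
    where x<z = proj₁ (from-x xz∈B)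
  old-new-noCross {a} a∈B t h xz∈B (inj₂ (_ , _ , y<hi)) =
    <⇒≱ (subst (_< hi a) (hi-new xz∈B) y<hi) (hi-old≤y t h)

  T-noCross : ∀ {a b} → a ∈ T → b ∈ T → ¬ Cross a b
  T-noCross ma mb c with classify ma | classify mb
  ... | old a∈B _ _ | old b∈B _ _ = noCross a∈B b∈B c
  ... | old a∈B t h | new z refl xz∈B = old-new-noCross a∈B t h xz∈B c
  ... | new z refl xz∈B | old b∈B t h = old-new-noCross b∈B t h xz∈B (cross-sym c)
  ... | new z refl xz∈B | new z' refl xz'∈B =
      [ (λ (_ , _ , r) → <-irrefl same-hi r) , (λ (_ , _ , r) → <-irrefl (sym same-hi) r) ]′ c
    where
    same-hi : hi (y , z) ≡ hi (y , z')
    same-hi = trans (hi-new xz∈B) (sym (hi-new xz'∈B))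

  T-fwdNest : ∀ {a b} → a ∈ T → b ∈ T → Forward a → Forward b → NestEachOther a b
  T-fwdNest ma mb fa fb with classify ma | classify mb
  ... | old a∈B _ _ | old b∈B _ _ = fwdNest a∈B b∈B fa fb
  ... | new z refl xz∈B | _ = ⊥-elim (new-notForward xz∈B fa)
  ... | old _ _ _ | new z refl xz∈B = ⊥-elim (new-notForward xz∈B fb)

  T-bwdNoNest : ∀ {a b} → a ∈ T → b ∈ T → Backward a → Forward b → ¬ Nests a b
  T-bwdNoNest {a} {b} ma mb ba fb with classify ma | classify mb
  ... | _ | new z refl xz∈B = ⊥-elim (new-notForward xz∈B fb)
  ... | old a∈B _ _ | old b∈B _ _ = bwdNoNest a∈B b∈B ba fb
  ... | new z refl xz∈B | old b∈B t h = λ (z≤lo , hi≤y) → case fwdNest xz∈B b∈B x<z fb of λ where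
      (inj₁ (_ , hi≤z)) → <⇒≱ (lo<hi b (<⇒≢ fb))
                            (≤-trans (subst (hi b ≤_) (hi-fwd x<z) hi≤z) (subst (_≤ lo b) (lo-new xz∈B) z≤lo))
      (inj₂ (lo≤x , _)) → <⇒≱ (x<lo-old t h) (subst (lo b ≤_) (lo-fwd x<z) lo≤x)
    where x<z = proj₁ (from-x xz∈B)

  T-headNotTail : ∀ {a b} → a ∈ T → b ∈ T → NonLoop a → NonLoop b → headA a ≢ tailA b
  T-headNotTail {a} {b} ma mb na nb h≡t with classify ma | classify mb
  ... | old a∈B _ _ | old b∈B _ _ = headNotTail a∈B b∈B na nb h≡t
  ... | new z refl xz∈B | old b∈B _ _ = headNotTail xz∈B b∈B (<⇒≢ (proj₁ (from-x xz∈B))) nb h≡t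
  ... | new z refl _ | new z' refl _ = na (sym h≡t)
  ... | old a∈B t h | new z' refl xz'∈B = old-head≢y a∈B t h na xz'∈B nb h≡t
    where
    old-head≢y : ∀ {a z} → a ∈ B → tailA a ∈ V' → headA a ∈ V' → NonLoop a → (x , z) ∈ B → y ≢ z → headA a ≢ y
    old-head≢y {a} {z} a∈B t h na xz∈B y≢z h≡y with fwd⊎bwd a na | from-x xz∈B
    ... | inj₂ bw | _ = <⇒≱ (subst (_< tailA a) h≡y bw) (y-max t)
    ... | inj₁ fw | x<z , _ with fwdNest a∈B xz∈B fw x<z
    ...   | inj₁ (lo≤x , _) = <⇒≱ (x<lo-old t h) (subst (lo a ≤_) (lo-fwd x<z) lo≤x)
    ...   | inj₂ (_ , z≤hi) = y≢z (≤-antisym (subst (_≤ z) (trans (hi-fwd fw) h≡y) (subst (hi a ≤_) (hi-fwd x<z) z≤hi))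
                                             (z≤y xz∈B))

  count-T : ∀ (p : Arrow → Bool) → count p T ≡ count (λ b → p b ∧ restrictᵇ V' b) B
                                                  + count (λ b → p (twistArrow b) ∧ isFromX b) B
  count-T p = trans (count-++ p (restrict V' B) _)
                    (cong₂ _+_ (count-filterᵇ (restrictᵇ V') p B)
                               (trans (count-map p twistArrow (filterᵇ isFromX B)) (count-filterᵇ isFromX (p ∘ twistArrow) B)))

  T-simple : ∀ c → NonLoop c → multiplicity c T ≤ 1
  T-simple c nc with tailA c ≟ y
  ... | yes c-tail≡y = begin
      multiplicity c T
        ≡⟨ count-T (λ a → does (c ≟ₐ a)) ⟩
      count (λ b → does (c ≟ₐ b) ∧ restrictᵇ V' b) B + count (λ b → does (c ≟ₐ twistArrow b) ∧ isFromX b) B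
        ≡⟨ cong (_+ count (λ b → does (c ≟ₐ twistArrow b) ∧ isFromX b) B) (count-none B noOld) ⟩
      count (λ b → does (c ≟ₐ twistArrow b) ∧ isFromX b) B
        ≤⟨ count-mono B fromXZ ⟩
      multiplicity (x , headA c) B
        ≤⟨ multiplicity≤1 adm (x , headA c) (λ m → <⇒≢ (proj₁ (from-x m))) ⟩
      1 ∎
    where
    open ≤-Reasoning
    noOld : ∀ {b} → b ∈ B → does (c ≟ₐ b) ∧ restrictᵇ V' b ≡ false
    noOld {b} m with c ≟ₐ b
    ... | yes refl = ⊥-elim (headNotTail xy∈B m xy-nonLoop nc (sym c-tail≡y))
    ... | no _ = refl
    fromXZ : ∀ {b} → b ∈ B → does (c ≟ₐ twistArrow b) ∧ isFromX b ≡ true → does ((x , headA c) ≟ₐ b) ≡ true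
    fromXZ {b} m e with ∧-elim e
    ... | c≡b′ , fromX = dec-true ((x , headA c) ≟ₐ b)
                           (cong₂ _,_ (sym (dec-true⁻ (tailA b ≟ x) fromX)) (cong headA (dec-true⁻ (c ≟ₐ twistArrow b) c≡b′)))
  ... | no c-tail≢y = begin
      multiplicity c T
        ≡⟨ count-T (λ a → does (c ≟ₐ a)) ⟩
      count (λ b → does (c ≟ₐ b) ∧ restrictᵇ V' b) B + count (λ b → does (c ≟ₐ twistArrow b) ∧ isFromX b) B
        ≡⟨ cong (_ +_) (count-none B noNew) ⟩
      count (λ b → does (c ≟ₐ b) ∧ restrictᵇ V' b) B + 0
        ≡⟨ +-identityʳ _ ⟩
      count (λ b → does (c ≟ₐ b) ∧ restrictᵇ V' b) B
        ≤⟨ count-mono B (λ {b} _ → ∧-conicalˡ (does (c ≟ₐ b)) _) ⟩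
      multiplicity c B
        ≤⟨ simple c nc ⟩
      1 ∎
    where
    open ≤-Reasoning
    noNew : ∀ {b} → b ∈ B → does (c ≟ₐ twistArrow b) ∧ isFromX b ≡ false
    noNew {b} _ rewrite dec-false (c ≟ₐ twistArrow b) (λ c≡ → c-tail≢y (trans (cong tailA c≡) top≡y)) = refl

  admissible : Admissible V' T
  admissible = record
    { sorted      = AllPairs.tail sorted
    ; endpoints   = T-endpoints
    ; loopsAtTop  = T-loopsAtTop
    ; noCross     = T-noCross
    ; fwdNest     = T-fwdNest
    ; bwdNoNest   = T-bwdNoNest
    ; headNotTail = T-headNotTail
    ; simple      = T-simple
    }
    where
    T-endpoints : ∀ {a} → a ∈ T → tailA a ∈ V' × headA a ∈ V'
    T-endpoints m with classify m
    ... | old _ t h = t , h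
    ... | new z refl xz∈B = y∈V' , proj₂ (from-x xz∈B)
    T-loopsAtTop : ∀ {a} → a ∈ T → tailA a ≡ headA a → ∀ {z} → z ∈ V' → z ≤ tailA a
    T-loopsAtTop m loop z∈V' with classify m
    ... | old a∈B _ _ = loopsAtTop a∈B loop (there z∈V')
    ... | new _ refl _ = y-max z∈V'

  fromX-nonLoop : ∀ {b} → b ∈ B → tailA b ≡ x → NonLoop b
  fromX-nonLoop {b} m t≡x loop =
    <⇒≢ (proj₁ (from-x (subst (_∈ B) (cong (_, headA b) t≡x) m))) (trans (sym t≡x) loop)

  x∉V' : inb x V' ≡ false
  x∉V' with inb x V' in e
  ... | false = refl
  ... | true = ⊥-elim (<-irrefl refl (x<V' (inb⇒∈ V' e)))

  arrow-twisted : ∀ {b} → b ∈ B → 𝟙 (nonLoopᵇ b) ≡ 𝟙 (nonLoopᵇ b ∧ restrictᵇ V' b) + 𝟙 (nonLoopᵇ (twistArrow b) ∧ isFromX b)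
                                          + 𝟙 (does ((x , y) ≟ₐ b))
  arrow-twisted {b} m with tailA b ≟ x | headA b ≟ y
  ... | yes t≡x | yes h≡y
      rewrite dec-true ((x , y) ≟ₐ b) (cong₂ _,_ (sym t≡x) (sym h≡y))
            | nonLoopᵇ-false {twistArrow b} (trans top≡y (sym h≡y))
            | nonLoopᵇ-true {b} (fromX-nonLoop m t≡x) | t≡x | x∉V' = refl
  ... | yes t≡x | no h≢y
      rewrite dec-false ((x , y) ≟ₐ b) (λ xy≡b → h≢y (sym (cong headA xy≡b)))
            | nonLoopᵇ-true {twistArrow b} (λ top≡h → h≢y (trans (sym top≡h) top≡y))
            | nonLoopᵇ-true {b} (fromX-nonLoop m t≡x) | t≡x | x∉V' | dec-true (x ≟ x) refl = refl
  ... | no t≢x | _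
      rewrite dec-false ((x , y) ≟ₐ b) (λ xy≡b → t≢x (sym (cong tailA xy≡b)))
            | dec-false (tailA b ≟ x) t≢x | ∧-zeroʳ (nonLoopᵇ (twistArrow b)) with tailA b ≟ headA b
  ...   | yes loop rewrite nonLoopᵇ-false {b} loop = refl
  ...   | no nl rewrite nonLoopᵇ-true {b} nl
                      | ∧-intro (∈⇒inb (Any.tail t≢x (proj₁ (endpoints m))))
                                (∈⇒inb (Any.tail (headNotTail m xy∈B nl xy-nonLoop) (proj₂ (endpoints m)))) = refl

  arrowCount-twist : arrowCount B ≡ suc (arrowCount T)
  arrowCount-twist = begin
    arrowCount B
      ≡⟨ count-split₃ B arrow-twisted ⟩
    count (λ b → nonLoopᵇ b ∧ restrictᵇ V' b) B + count (λ b → nonLoopᵇ (twistArrow b) ∧ isFromX b) B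
      + multiplicity (x , y) B
      ≡⟨ cong₂ _+_ (sym (count-T nonLoopᵇ)) (multiplicity-∈ xy∈B (simple (x , y) xy-nonLoop)) ⟩
    arrowCount T + 1
      ≡⟨ +-comm _ 1 ⟩
    suc (arrowCount T) ∎
    where open ≡-Reasoning

DP-BalancedUpTo : ℕ → Set
DP-BalancedUpTo f = ∀ V A → length V ≤ f → 1 ≤ length V → Admissible V A → Balanced (DPf f V A) V A

twisted-balanced : ∀ {f x y L B}
  → DP-BalancedUpTo f
  → Admissible L B → (x , y) ∈ B → x < y → x ∈ L → y ∈ L → (∀ {z} → z ∈ L → x ≤ z × z ≤ y) → length L ≤ suc f
  → Balanced (DPf f (proj₁ (tw L B)) (proj₂ (tw L B))) (proj₁ (tw L B)) (proj₂ (tw L B))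
    × length L ≡ suc (length (proj₁ (tw L B))) × arrowCount B ≡ suc (arrowCount (proj₂ (tw L B)))
twisted-balanced {f} {x} {y} {x' ∷ V'} {B} IH adm xy∈B x<y x∈L y∈L bounds len with x∈L
... | there x∈V' with Admissible.sorted adm
...   | x'<V ∷ _ = ⊥-elim (<⇒≱ (All.lookup x'<V x∈V') (proj₁ (bounds (here refl))))
twisted-balanced {f} {x} {y} {x ∷ V'} {B} IH adm xy∈B x<y x∈L y∈L bounds len | here refl =
  IH V' T (≤-pred len) (∈⇒1≤length y∈V') admissible , refl , arrowCount-twist
  where
  y∈V' : y ∈ V'
  y∈V' = Any.tail (λ y≡x → <-irrefl (sym y≡x) x<y) y∈L
  open Twist x y V' B adm xy∈B x<y y∈V' (λ z∈V' → proj₂ (bounds (there z∈V')))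

-- DP

box : ℕ → ℕ → ℕ → Bool
box α β z = (α ≤ᵇ z) ∧ (z ≤ᵇ β)

arrowInBox : ℕ → ℕ → Arrow → Bool
arrowInBox α β a = box α β (tailA a) ∧ box α β (headA a)

module _ {α β : ℕ} where

  box-true : ∀ {z} → α ≤ z → z ≤ β → box α β z ≡ true
  box-true {z} = does-∧ (α ≤? z) (z ≤? β)

  box-false : ∀ {z} → (α ≤ z → z ≤ β → ⊥) → box α β z ≡ false
  box-false {z} = does-∧-false (α ≤? z) (z ≤? β)

  box⁻ : ∀ {z} → box α β z ≡ true → α ≤ z × z ≤ β
  box⁻ {z} = does-∧⁻ (α ≤? z) (z ≤? β)

  arrowInBox-true : ∀ {a} → α ≤ lo a → hi a ≤ β → arrowInBox α β a ≡ true
  arrowInBox-true {a} α≤lo hi≤β = ∧-intro (box-true (≤-trans α≤lo (lo≤tail a)) (≤-trans (tail≤hi a) hi≤β))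
                                          (box-true (≤-trans α≤lo (lo≤head a)) (≤-trans (head≤hi a) hi≤β))

  arrowInBox⁻ : ∀ {a} → arrowInBox α β a ≡ true → α ≤ lo a × hi a ≤ β
  arrowInBox⁻ {a} e with ∧-elim e
  ... | t , h = let (α≤t , t≤β) = box⁻ t ; (α≤h , h≤β) = box⁻ h in ⊓-glb α≤t α≤h , ⊔-lub t≤β h≤β

  arrowInBox-false : ∀ {a} → (α ≤ lo a → hi a ≤ β → ⊥) → arrowInBox α β a ≡ false
  arrowInBox-false {a} outside with arrowInBox α β a in e
  ... | false = refl
  ... | true = ⊥-elim (uncurry outside (arrowInBox⁻ e))

nestsᵇ-true : ∀ {a b} → Nests a b → nestsᵇ a b ≡ true
nestsᵇ-true {a} {b} = uncurry (does-∧ (lo a ≤? lo b) (hi b ≤? hi a))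

nestsᵇ⁻ : ∀ {a b} → nestsᵇ a b ≡ true → Nests a b
nestsᵇ⁻ {a} {b} = does-∧⁻ (lo a ≤? lo b) (hi b ≤? hi a)

findOuter-just : ∀ L M {o} → findOuter L M ≡ just o → o ∈ L × (∀ {b} → b ∈ M → Nests o b)
findOuter-just (a ∷ as) M e with all (nestsᵇ a) M in nestsAll
findOuter-just (a ∷ as) M refl | true = here refl , λ m → nestsᵇ⁻ (all≡true (nestsᵇ a) nestsAll m)
... | false = let (m , h) = findOuter-just as M e in there m , h

findOuter-complete : ∀ L M {o} → o ∈ L → (∀ {b} → b ∈ M → Nests o b) → findOuter L M ≢ nothing
findOuter-complete (a ∷ as) M m outer e with all (nestsᵇ a) M in nestsAll
findOuter-complete (a ∷ as) M m outer () | true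
findOuter-complete (a ∷ as) M (here refl) outer e | false =
  true≢false (trans (sym (all-intro (nestsᵇ a) M (nestsᵇ-true ∘ outer))) nestsAll)
findOuter-complete (a ∷ as) M (there m) outer e | false = findOuter-complete as M m outer e

outermost : ∀ a L → (∀ {p q} → p ∈ a ∷ L → q ∈ a ∷ L → NestEachOther p q)
          → ∃ λ o → o ∈ a ∷ L × (∀ {b} → b ∈ a ∷ L → Nests o b)
outermost a [] _ = a , here refl , λ { (here refl) → ≤-refl , ≤-refl }
outermost a (b ∷ L) nest with outermost b L (λ p q → nest (there p) (there q))
... | o , o∈ , o-outer with nest (here refl) (there o∈)
...   | inj₁ a⊇o = a , here refl , λ { (here refl) → ≤-refl , ≤-refl ; (there m) → nests-trans a⊇o (o-outer m) }
...   | inj₂ o⊇a = o , there o∈ , λ { (here refl) → o⊇a ; (there m) → o-outer m }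

module DP-split
  (f : ℕ) (V : List ℕ) (A : List Arrow) (x y : ℕ)
  (IH : DP-BalancedUpTo f)
  (adm : Admissible V A) (len : length V ≤ suc f)
  (xy∈A : (x , y) ∈ A) (x<y : x < y) (outer : ∀ {a} → a ∈ A → Forward a → Nests (x , y) a)
  where

  open Admissible adm

  v w : ℕ
  v = minList1 x V
  w = maxList V

  W₁ W₂ W₃ : List ℕ
  W₁ = filterᵇ (box v x) V
  W₂ = filterᵇ (box x y) V
  W₃ = filterᵇ (box y w) V

  x∈V : x ∈ V
  x∈V = proj₁ (endpoints xy∈A)

  y∈V : y ∈ V
  y∈V = proj₂ (endpoints xy∈A)

  v≤ : ∀ {z} → z ∈ V → v ≤ z
  v≤ m = minList1-≤ x V (there m)

  ≤w : ∀ {z} → z ∈ V → z ≤ w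
  ≤w = ≤maxList V

  xy-nonLoop : NonLoop (x , y)
  xy-nonLoop = <⇒≢ x<y

  fwd-inside : ∀ {a} → a ∈ A → Forward a → x ≤ lo a × hi a ≤ y
  fwd-inside {a} m fw = let (p , q) = outer m fw in subst (_≤ lo a) (lo-fwd x<y) p , subst (hi a ≤_) (hi-fwd x<y) q

  data Region (a : Arrow) : Set where
    left   : hi a ≤ x → Region a
    middle : x ≤ lo a → hi a ≤ y → Region a
    right  : y ≤ lo a → Region a

  region : ∀ {a} → a ∈ A → NonLoop a → Region a
  region {a} m nl with hi a ≤? x | y ≤? lo a
  ... | yes hi≤x | _ = left hi≤x
  ... | no _ | yes y≤lo = right y≤lo
  ... | no hi≰x | no y≰lo with x ≤? lo a | hi a ≤? y
  ...   | yes x≤lo | yes hi≤y = middle x≤lo hi≤y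
  ...   | yes x≤lo | no hi≰y with m≤n⇒m<n∨m≡n x≤lo | fwd⊎bwd a nl
  ...     | inj₁ x<lo | _ = ⊥-elim (noCross xy∈A m (inj₁ ( subst (_< lo a) (sym (lo-fwd x<y)) x<lo
                                                        , subst (lo a <_) (sym (hi-fwd x<y)) (≰⇒> y≰lo)
                                                        , subst (_< hi a) (sym (hi-fwd x<y)) (≰⇒> hi≰y) )))
  ...     | inj₂ _ | inj₁ fw = ⊥-elim (hi≰y (proj₂ (fwd-inside m fw)))
  ...     | inj₂ x≡lo | inj₂ bw = ⊥-elim (headNotTail m xy∈A nl xy-nonLoop (trans (sym (lo-bwd bw)) (sym x≡lo)))
  region {a} m nl | no hi≰x | no y≰lo | no x≰lo | _ with hi a <? y | fwd⊎bwd a nl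
  ... | yes hi<y | _ = ⊥-elim (noCross m xy∈A (inj₁ ( subst (lo a <_) (sym (lo-fwd x<y)) (≰⇒> x≰lo)
                                                    , subst (_< hi a) (sym (lo-fwd x<y)) (≰⇒> hi≰x)
                                                    , subst (hi a <_) (sym (hi-fwd x<y)) hi<y )))
  ... | no _ | inj₁ fw = ⊥-elim (x≰lo (proj₁ (fwd-inside m fw)))
  ... | no hi≮y | inj₂ bw = ⊥-elim (bwdNoNest m xy∈A bw x<y ( subst (lo a ≤_) (sym (lo-fwd x<y)) (<⇒≤ (≰⇒> x≰lo))
                                                             , subst (_≤ hi a) (sym (hi-fwd x<y)) (≮⇒≥ hi≮y) ))

  node-boxes : ∀ {z} → z ∈ V → 𝟙 (box v x z) + 𝟙 (box x y z) + 𝟙 (box y w z) ≡ 𝟙 true + 𝟙 (z ≡ᵇ x) + 𝟙 (z ≡ᵇ y)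
  node-boxes {z} m with <-cmp z x | <-cmp z y
  ... | tri< z<x _ _ | _
      rewrite box-true {v} {x} (v≤ m) (<⇒≤ z<x) | box-false {x} {y} (λ x≤z _ → <⇒≱ z<x x≤z)
            | box-false {y} {w} (λ y≤z _ → <⇒≱ (<-trans z<x x<y) y≤z)
            | dec-false (z ≟ x) (<⇒≢ z<x) | dec-false (z ≟ y) (<⇒≢ (<-trans z<x x<y)) = refl
  ... | tri≈ _ refl _ | _
      rewrite box-true {v} {z} (v≤ m) ≤-refl | box-true {z} {y} ≤-refl (<⇒≤ x<y)
            | box-false {y} {w} (λ y≤z _ → <⇒≱ x<y y≤z)
            | dec-true (z ≟ z) refl | dec-false (z ≟ y) (<⇒≢ x<y) = refl
  ... | tri> _ _ x<z | tri< z<y _ _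
      rewrite box-false {v} {x} (λ _ z≤x → <⇒≱ x<z z≤x) | box-true {x} {y} (<⇒≤ x<z) (<⇒≤ z<y)
            | box-false {y} {w} (λ y≤z _ → <⇒≱ z<y y≤z)
            | dec-false (z ≟ x) (≢-sym (<⇒≢ x<z)) | dec-false (z ≟ y) (<⇒≢ z<y) = refl
  ... | tri> _ _ x<z | tri≈ _ refl _
      rewrite box-false {v} {x} (λ _ z≤x → <⇒≱ x<z z≤x) | box-true {x} {z} (<⇒≤ x<z) ≤-refl
            | box-true {z} {w} ≤-refl (≤w m)
            | dec-false (z ≟ x) (≢-sym (<⇒≢ x<z)) | dec-true (z ≟ z) refl = refl
  ... | tri> _ _ x<z | tri> _ _ y<z
      rewrite box-false {v} {x} (λ _ z≤x → <⇒≱ x<z z≤x) | box-false {x} {y} (λ _ z≤y → <⇒≱ y<z z≤y)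
            | box-true {y} {w} (<⇒≤ y<z) (≤w m)
            | dec-false (z ≟ x) (≢-sym (<⇒≢ x<z)) | dec-false (z ≟ y) (≢-sym (<⇒≢ y<z)) = refl

  -- x and y each lie in two of the three boxes.
  lengths : length W₁ + length W₂ + length W₃ ≡ length V + 2
  lengths = begin
    length W₁ + length W₂ + length W₃
      ≡⟨ count-+₃ (box v x) (box x y) (box y w) V ⟩
    sumOver (λ z → 𝟙 (box v x z) + 𝟙 (box x y z) + 𝟙 (box y w z)) V
      ≡⟨ sumOver-cong V node-boxes ⟩
    sumOver (λ z → 𝟙 true + 𝟙 (z ≡ᵇ x) + 𝟙 (z ≡ᵇ y)) V
      ≡⟨ count-+₃ (λ _ → true) (_≡ᵇ x) (_≡ᵇ y) V ⟨
    count (λ _ → true) V + count (_≡ᵇ x) V + count (_≡ᵇ y) V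
      ≡⟨ cong₂ _+_ (cong₂ _+_ (count-true V) (count-≡ᵇ-sorted sorted x∈V)) (count-≡ᵇ-sorted sorted y∈V) ⟩
    length V + 1 + 1
      ≡⟨ +-assoc (length V) 1 1 ⟩
    length V + 2 ∎
    where open ≡-Reasoning

  B₁ B₂ B₃ : List Arrow
  B₁ = restrict W₁ A
  B₂ = restrict W₂ A
  B₃ = restrict W₃ A

  restrictᵇ-box : ∀ α β {a} → a ∈ A → restrictᵇ (filterᵇ (box α β) V) a ≡ arrowInBox α β a
  restrictᵇ-box α β m = restrictᵇ-filterᵇ (box α β) (proj₁ (endpoints m)) (proj₂ (endpoints m))

  arrow-boxes : ∀ {a} → a ∈ A → 𝟙 (nonLoopᵇ a) ≡ 𝟙 (nonLoopᵇ a ∧ restrictᵇ W₁ a) + 𝟙 (nonLoopᵇ a ∧ restrictᵇ W₂ a)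
                                                + 𝟙 (nonLoopᵇ a ∧ restrictᵇ W₃ a)
  arrow-boxes {a} m rewrite restrictᵇ-box v x m | restrictᵇ-box x y m | restrictᵇ-box y w m with tailA a ≟ headA a
  ... | yes loop rewrite nonLoopᵇ-false {a} loop = refl
  ... | no nl rewrite nonLoopᵇ-true {a} nl with region m nl
  ...   | left hi≤x
          rewrite arrowInBox-true {v} {x} {a} (v≤ (lo-elim (_∈ V) a (proj₁ (endpoints m)) (proj₂ (endpoints m)))) hi≤x
                | arrowInBox-false {x} {y} {a} (λ x≤lo _ → <⇒≱ (lo<hi a nl) (≤-trans hi≤x x≤lo))
                | arrowInBox-false {y} {w} {a} (λ y≤lo _ → <⇒≱ (<-≤-trans (lo<hi a nl) (≤-trans hi≤x (<⇒≤ x<y))) y≤lo) = refl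
  ...   | middle x≤lo hi≤y
          rewrite arrowInBox-false {v} {x} {a} (λ _ hi≤x → <⇒≱ (lo<hi a nl) (≤-trans hi≤x x≤lo))
                | arrowInBox-true {x} {y} {a} x≤lo hi≤y
                | arrowInBox-false {y} {w} {a} (λ y≤lo _ → <⇒≱ (lo<hi a nl) (≤-trans hi≤y y≤lo)) = refl
  ...   | right y≤lo
          rewrite arrowInBox-false {v} {x} {a} (λ _ hi≤x → <⇒≱ (<-≤-trans (lo<hi a nl) (≤-trans hi≤x (<⇒≤ x<y))) y≤lo)
                | arrowInBox-false {x} {y} {a} (λ _ hi≤y → <⇒≱ (lo<hi a nl) (≤-trans hi≤y y≤lo))
                | arrowInBox-true {y} {w} {a} y≤lo (≤w (hi-elim (_∈ V) a (proj₁ (endpoints m)) (proj₂ (endpoints m)))) = refl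

  partition : arrowCount A ≡ arrowCount B₁ + arrowCount B₂ + arrowCount B₃
  partition = trans (count-split₃ A arrow-boxes)
    (sym (cong₂ _+_ (cong₂ _+_ (arrowCount-restrict W₁ A) (arrowCount-restrict W₂ A)) (arrowCount-restrict W₃ A)))

  box-admissible : ∀ α β → Admissible (filterᵇ (box α β) V) (restrict (filterᵇ (box α β) V) A)
  box-admissible α β =
    restrict-admissible adm (AllPairsₚ.filter⁺ (T? ∘ box α β) sorted) (proj₁ ∘ ∈-filterᵇ⁻ (box α β) {V})

  in-box : ∀ α β {a} → a ∈ restrict (filterᵇ (box α β) V) A → a ∈ A × α ≤ lo a × hi a ≤ β
  in-box α β {a} m with ∈-restrict⁻ {filterᵇ (box α β) V} {A} m
  ... | a∈A , t , h = a∈A , arrowInBox⁻ (trans (sym (restrictᵇ-box α β a∈A)) (∧-intro (∈⇒inb t) (∈⇒inb h)))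

  noForward₁ : NoForward B₁
  noForward₁ {a} m fw = let (a∈A , _ , hi≤x) = in-box v x m in
    <⇒≱ (lo<hi a (<⇒≢ fw)) (≤-trans hi≤x (proj₁ (fwd-inside a∈A fw)))

  noForward₃ : NoForward B₃
  noForward₃ {a} m fw = let (a∈A , y≤lo , _) = in-box y w m in
    <⇒≱ (lo<hi a (<⇒≢ fw)) (≤-trans (proj₂ (fwd-inside a∈A fw)) y≤lo)

  x∈W₁ : x ∈ W₁
  x∈W₁ = ∈-filterᵇ⁺ (box v x) x∈V (box-true (v≤ x∈V) ≤-refl)

  x∈W₂ : x ∈ W₂
  x∈W₂ = ∈-filterᵇ⁺ (box x y) x∈V (box-true ≤-refl (<⇒≤ x<y))

  y∈W₂ : y ∈ W₂
  y∈W₂ = ∈-filterᵇ⁺ (box x y) y∈V (box-true (<⇒≤ x<y) ≤-refl)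

  y∈W₃ : y ∈ W₃
  y∈W₃ = ∈-filterᵇ⁺ (box y w) y∈V (box-true ≤-refl (≤w y∈V))

  xy∈B₂ : (x , y) ∈ B₂
  xy∈B₂ = ∈-filterᵇ⁺ (restrictᵇ W₂) xy∈A (∧-intro (∈⇒inb x∈W₂) (∈⇒inb y∈W₂))

  twisted : Balanced (DPf f (proj₁ (tw W₂ B₂)) (proj₂ (tw W₂ B₂))) (proj₁ (tw W₂ B₂)) (proj₂ (tw W₂ B₂))
            × length W₂ ≡ suc (length (proj₁ (tw W₂ B₂))) × arrowCount B₂ ≡ suc (arrowCount (proj₂ (tw W₂ B₂)))
  twisted = twisted-balanced IH (box-admissible x y) xy∈B₂ x<y x∈W₂ y∈W₂
              (box⁻ ∘ proj₂ ∘ ∈-filterᵇ⁻ (box x y) {V})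
              (≤-trans (length-filter (T? ∘ box x y) V) len)

  balanced : Balanced (SP W₁ B₁ ++ D ∷ DPf f (proj₁ (tw W₂ B₂)) (proj₂ (tw W₂ B₂)) ++ U ∷ SP W₃ B₃) V A
  balanced = balanced-DU
    (SP-balanced (length W₁) W₁ B₁ ≤-refl (∈⇒1≤length x∈W₁) (box-admissible v x) noForward₁)
    (proj₁ twisted)
    (SP-balanced (length W₃) W₃ B₃ ≤-refl (∈⇒1≤length y∈W₃) (box-admissible y w) noForward₃)
    (trans (cong (λ n → length W₁ + n + length W₃) (sym (proj₁ (proj₂ twisted)))) lengths)
    (trans partition (cong (λ n → arrowCount B₁ + n + arrowCount B₃) (proj₂ (proj₂ twisted))))

∈-forwards⁻ : ∀ {A fs} → filterᵇ isFwdᵇ A ≡ fs → ∀ {a} → a ∈ fs → a ∈ A × Forward a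
∈-forwards⁻ {A} refl {a} m = let (a∈A , fw) = ∈-filterᵇ⁻ isFwdᵇ {A} m in a∈A , dec-true⁻ (tailA a <? headA a) fw

∈-forwards⁺ : ∀ {A fs} → filterᵇ isFwdᵇ A ≡ fs → ∀ {a} → a ∈ A → Forward a → a ∈ fs
∈-forwards⁺ refl {a} m fw = ∈-filterᵇ⁺ isFwdᵇ m (dec-true (tailA a <? headA a) fw)

DP-balanced : ∀ f → DP-BalancedUpTo f
DP-balanced zero (_ ∷ _) A () _ _
DP-balanced (suc f) V A len pos adm with filterᵇ isFwdᵇ A in forwards
... | [] = SP-balanced (length V) V A ≤-refl pos adm (λ m fw → case ∈-forwards⁺ {A} forwards m fw of λ ())
... | b ∷ bs with findOuter (b ∷ bs) (b ∷ bs) in found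
...   | nothing = ⊥-elim (findOuter-complete (b ∷ bs) (b ∷ bs) (proj₁ (proj₂ outer)) (proj₂ (proj₂ outer)) found)
  where
  forward : ∀ {a} → a ∈ b ∷ bs → a ∈ A × Forward a
  forward = ∈-forwards⁻ {A} forwards
  outer : ∃ λ o → o ∈ b ∷ bs × (∀ {a} → a ∈ b ∷ bs → Nests o a)
  outer = outermost b bs λ p q →
    Admissible.fwdNest adm (proj₁ (forward p)) (proj₁ (forward q)) (proj₂ (forward p)) (proj₂ (forward q))
...   | just (x , y) = DP-split.balanced f V A x y (DP-balanced f) adm len
                         (proj₁ (∈-forwards⁻ {A} forwards xy∈)) (proj₂ (∈-forwards⁻ {A} forwards xy∈))
                         (λ m fw → xy-outer (∈-forwards⁺ {A} forwards m fw))
  where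
  xy∈ : (x , y) ∈ b ∷ bs
  xy∈ = proj₁ (findOuter-just (b ∷ bs) (b ∷ bs) found)
  xy-outer : ∀ {a} → a ∈ b ∷ bs → Nests (x , y) a
  xy-outer = proj₂ (findOuter-just (b ∷ bs) (b ∷ bs) found)

valid⇒admissible : ∀ {V A} → IsNodeSet V → ValidDigraph V A → Unique A → Admissible V A
valid⇒admissible {V} {A} (increasing , _) valid unique = record
  { sorted      = Linked⇒AllPairs <-trans increasing
  ; endpoints   = λ m → let (t , h , _) = All.lookup arrowsOnV m in t , h
  ; loopsAtTop  = λ m loop → ⊥-elim (proj₂ (proj₂ (All.lookup arrowsOnV m)) loop)
  ; noCross     = noCross
  ; fwdNest     = fwdNest
  ; bwdNoNest   = bwdNoNest
  ; headNotTail = λ m₁ m₂ _ _ → headNotTail m₁ m₂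
  ; simple      = λ c _ → multiplicity-unique c unique
  }
  where
  open ValidDigraph valid
  multiplicity-unique : ∀ c {A} → Unique A → multiplicity c A ≤ 1
  multiplicity-unique c {[]} [] = z≤n
  multiplicity-unique c {a ∷ A} (a∉A ∷ unique) with c ≟ₐ a
  ... | no _ = multiplicity-unique c unique
  ... | yes refl = s≤s (≤-reflexive (count-none A (λ {b} m → dec-false (c ≟ₐ b) (λ { refl → All.lookup a∉A m refl }))))

arrowCount-valid : ∀ {V A} → ValidDigraph V A → arrowCount A ≡ length A
arrowCount-valid {V} {A} valid = trans (count-cong A (λ m → nonLoopᵇ-true (proj₂ (proj₂ (All.lookup arrowsOnV m)))))
                                       (count-true A)
  where open ValidDigraph valid

lemma8p6 : (n k : ℕ) (V : List ℕ) (A : List Arrow)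
    → IsNodeSet V → length V ≡ suc n
    → ValidDigraph V A → Unique A → length A ≡ k
    → wordLength (DP V A) ≡ 2 * n × countU (DP V A) ≡ k × countD (DP V A) ≡ k
lemma8p6 n k V A nodes lenV valid unique lenA =
    +-cancelʳ-≡ 2 _ _ (trans length≡ (trans (cong (2 *_) lenV) (double-suc n)))
  , trans countU≡ arrows
  , trans countD≡ arrows
  where
  open Balanced (DP-balanced (length V) V A ≤-refl (subst (1 ≤_) (sym lenV) (s≤s z≤n))
                             (valid⇒admissible nodes valid unique))
  arrows : arrowCount A ≡ k
  arrows = trans (arrowCount-valid valid) lenA
  double-suc : ∀ n → 2 * suc n ≡ 2 * n + 2
  double-suc = solve-∀
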